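{- Let $\mathcal{D}_h,\mathcal{D}_l$ be NDBATs, $m$ an NDBAT refinement mapping from $\mathcal{D}_h$ to $\mathcal{D}_l$ proper wrt $\mathcal{D}_l$, $M_h\models\mathcal{D}_h\cup\mathcal{C}$, $M_l\models\mathcal{D}_l\cup\mathcal{C}$, and suppose $M_h\sim_m M_l$. Then for any sequence $\vec\alpha$ of high-level agent actions, any high-level situation-suppressed formula $\phi$ and any variable assignment $v$: $M_l,v\models\exists s'.Do_{ag}(m_a(\vec\alpha),S_0,s')\wedge m_f(\phi)[s']$ if and only if $M_h,v\models\exists s'.Do_{ag}(\vec\alpha,S_0,s')\wedge\phi[s']$.
   Context: Framework: the situation calculus. Situations: $S_0$ and $do(a,s)$. $Executable(s)$ means every action performed in reaching $s$ was possible when performed. A situation-suppressed formula has situation arguments of fluents removed; $\phi[s]$ restores $s$. $M,v\models\phi$: model $M$ and variable assignment $v$ satisfy $\phi$; $v[x/d]$ is $v$ modified at $x$. $\vec\alpha$ may contain free variables in action parameters, but its action function symbols are given. NDBAT: a basic action theory (foundational axioms, initial-state axioms, unique-name axioms for actions, successor state axioms, precondition axioms $Poss(A(\vec x,e),s)\equiv\phi^{Poss}_A(\vec x,e,s)$) in which every action function $A(\vec x,e)$ has a final argument $e$ of sort Reaction. $A(\vec x,e)$ is a system action, $A(\vec x)$ the agent action, with agent precondition $Poss_{ag}(A(\vec x),s)$; the theory entails $\forall e.Poss(A(\vec x,e),s)\supset Poss_{ag}(A(\vec x),s)$ and $Poss_{ag}(A(\vec x),s)\supset\exists e.Poss(A(\vec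 x,e),s)$. For a sequence of agent actions: $Do_{ag}(\epsilon,s,s')\doteq s'=s$, $Do_{ag}([A(\vec x),\sigma],s,s')\doteq\exists e.Poss(A(\vec x,e),s)\wedge Do_{ag}(\sigma,do(A(\vec x,e),s),s')$. ConGolog programs $\delta::=\alpha\mid\varphi?\mid\delta_1;\delta_2\mid\delta_1|\delta_2\mid\pi x.\delta\mid\delta^*\mid\delta_1\|\delta_2$ ($nil=True?$). $\mathcal{C}$ axiomatizes $Trans,Final$: $Trans(\alpha,s,\delta',s')\equiv s'=do(\alpha,s)\wedge Poss(\alpha,s)\wedge\delta'=True?$; $Trans(\varphi?,s,\delta',s')\equiv False$; $Trans(\delta_1;\delta_2,s,\delta',s')\equiv(Trans(\delta_1,s,\delta_1',s')\wedge\delta'=\delta_1';\delta_2)\vee(Final(\delta_1,s)\wedge Trans(\delta_2,s,\delta',s'))$; choice: disjunction; $\pi$: existential; $Trans(\delta^*,s,\delta',s')\equiv Trans(\delta,s,\delta'',s')\wedge\delta'=\delta'';\delta^*$; $\|$: interleaving. $Final(\alpha,s)\equiv False$, $Final(\varphi?,s)\equiv\varphi[s]$, sequence and $\|$: conjunction, choice: disjunction, $\pi$: existential, $Final(\delta^*,s)\equiv True$. $Do(\delta,s,s')\doteq\exists\delta'.Trans^*(\delta,s,\delta',s')\wedge Final(\delta',s')$. Agent programs (atoms are agent actions) use $Trans(A(\vec x),s,\delta',s')\equiv\exists e.Poss(A(\vec x,e),s)\wedge\delta'=True?\wedge s'=do(A(\vec x,e),s)$; $Do_{ag}(\delta,s,s')$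 is $Do$ under this semantics (agreeing with the sequence definition above). SD: $Trans^*(\delta,s,\delta',s')\wedge Trans^*(\delta,s,\delta'',s')\supset\delta'=\delta''$. Abstraction setting: high-level NDBAT $\mathcal{D}_h$ (finite action types $\mathcal{A}_h$, fluents $\mathcal{F}_h$), low-level NDBAT $\mathcal{D}_l$, sharing only a countably infinite set of standard object names (unique names, domain closure; Reaction a subsort of Object); no functions other than constants, no non-fluent predicates. A refinement mapping $m=\langle m_a,m_s,m_f\rangle$ maps each $A\in\mathcal{A}_h$ to an SD low-level agent program $m_a(A(\vec x))$ and an SD low-level system program $m_s(A(\vec x,e))$, and each high-level fluent $F(\vec x)$ to a situation-suppressed low-level formula $m_f(F(\vec x))$; extended to sequences by composition with ";" ($m(\epsilon)=nil$), and to formulas by replacing fluents by their images. Proper wrt $\mathcal{D}_l$: for all high-level system action sequences $\vec\alpha$ and $A$, $\mathcal{D}_l\cup\mathcal{C}\models\forall s.(Do(m_s(\vec\alpha),S_0,s)\supset\forall\vec x,s'.(Do_{ag}(m_a(A(\vec x)),s,s')\equiv\exists e.Do(m_s(A(\vec x,e)),s,s')))$. $s_h\sim_m^{M_h,M_l}s_l$ iff for every $F\in\mathcal{F}_h$ and assignment $v$: $M_h,v[s/s_h]\models F(\vec x,s)$ iff $M_l,v[s/s_l]\models m_f(F(\vec x))[s]$. An $m$-bisimulation $B$ satisfies, for $\langle s_h,s_l\rangle\in B$: (i) $s_h\sim_m^{M_h,M_l}s_l$; (ii) for each $A\in\mathcal{A}_h$, if $M_h,v[s/s_h,s'/s_h']\models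 Poss(A(\vec x,e),s)\wedge s'=do(A(\vec x,e),s)$ then some $s_l'$ has $M_l,v[s/s_l,s'/s_l']\models Do(m_s(A(\vec x,e)),s,s')$ and $\langle s_h',s_l'\rangle\in B$; (iii) conversely from $Do(m_s(A(\vec x,e)),s_l,s_l')$ to some $s_h'=do(A(\vec x,e),s_h)$ with $Poss$ and $\langle s_h',s_l'\rangle\in B$. $M_h\sim_m M_l$ iff some $m$-bisimulation relates $S_0^{M_h}$ and $S_0^{M_l}$. -}

module Defs where

open import Data.Nat using (ℕ; zero; suc; _+_; _∸_; _<ᵇ_; _≡ᵇ_)
open import Data.Fin using (Fin)
open import Data.Vec using (Vec; []; _∷_; map; lookup; _++_; _∷ʳ_)
open import Data.List using (List; []; _∷_)
open import Data.Bool using (Bool; true; false; T; if_then_else_)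
open import Data.Unit using (⊤; tt)
open import Data.Empty using (⊥)
open import Data.Product using (Σ; _×_; _,_)
open import Data.Sum using (_⊎_)
open import Relation.Nullary using (¬_)
open import Relation.Binary.PropositionalEquality using (_≡_)
open import Function.Bundles using (_⇔_)

-- Finitely many action function symbols A (arity = number of object
-- arguments x⃗; every action additionally has the final Reaction
-- argument e) and finitely many relational fluents.

record Sig : Set where
  field
    nA  : ℕ
    ar  : Fin nA → ℕ
    nF  : ℕ
    far : Fin nF → ℕ

-- Objects are the standard names (= ℕ).  Variables are
-- de Bruijn indices; 'par j' are the formal parameters of a template
-- (e.g. the x⃗ of m_f(F(x⃗)) or of m_a(A(x⃗)), or the x⃗,e of
-- Poss(A(x⃗,e),s) ≡ φ(x⃗,e)).

data Term (k : ℕ) : Set where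
  var : ℕ → Term k
  nm  : ℕ → Term k
  par : Fin k → Term k

substT : ℕ → ℕ → Term 0 → Term 0
substT n d (var i) = if i <ᵇ n then var i else (if i ≡ᵇ n then nm d else var (i ∸ 1))
substT n d (nm c)  = nm c
substT n d (par ())

liftT : ℕ → Term 0 → Term 0
liftT n (var i) = var (n + i)
liftT n (nm c)  = nm c
liftT n (par ())

-- instantiate parameters by terms (capture avoiding: lifted by depth n)
instT : ∀ {k} → ℕ → Vec (Term 0) k → Term k → Term 0
instT n ts (var i) = var i
instT n ts (nm c)  = nm c
instT n ts (par j) = liftT n (lookup ts j)

module Lang (S : Sig) where
  open Sig S

  data Formula (k : ℕ) : Set where
    ⊤f  : Formula k
    fl  : (F : Fin nF) → Vec (Term k) (far F) → Formula k
    eq  : Term k → Term k → Formula k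
    neg : Formula k → Formula k
    and : Formula k → Formula k → Formula k
    ex  : Formula k → Formula k      -- ∃ x (sort Object)
    exR : Formula k → Formula k      -- ∃ e (sort Reaction)

  -- b = true : system programs (atoms A(t⃗, t_e))
  -- b = false: agent programs  (atoms A(t⃗))
  Ext : Bool → ℕ → Set
  Ext true  k = Term k
  Ext false k = ⊤

  data Prog (b : Bool) (k : ℕ) : Set where
    act  : (A : Fin nA) → Vec (Term k) (ar A) → Ext b k → Prog b k
    test : Formula k → Prog b k
    seq  : Prog b k → Prog b k → Prog b k
    alt  : Prog b k → Prog b k → Prog b k
    pi   : Prog b k → Prog b k
    star : Prog b k → Prog b k
    conc : Prog b k → Prog b k → Prog b k

  nil : ∀ {b k} → Prog b k
  nil = test ⊤f

  ClosedT : ∀ {k} → ℕ → Term k → Set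
  ClosedT n (var i) = T (i <ᵇ n)
  ClosedT n (nm c) = ⊤
  ClosedT n (par j) = ⊤

  ClosedTs : ∀ {k m} → ℕ → Vec (Term k) m → Set
  ClosedTs n [] = ⊤
  ClosedTs n (t ∷ ts) = ClosedT n t × ClosedTs n ts

  ClosedF : ∀ {k} → ℕ → Formula k → Set
  ClosedF n ⊤f = ⊤
  ClosedF n (fl F ts) = ClosedTs n ts
  ClosedF n (eq t u) = ClosedT n t × ClosedT n u
  ClosedF n (neg φ) = ClosedF n φ
  ClosedF n (and φ ψ) = ClosedF n φ × ClosedF n ψ
  ClosedF n (ex φ) = ClosedF (suc n) φ
  ClosedF n (exR φ) = ClosedF (suc n) φ

  ClosedE : ∀ b {k} → ℕ → Ext b k → Set
  ClosedE true n t = ClosedT n t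
  ClosedE false n t = ⊤

  ClosedP : ∀ {b k} → ℕ → Prog b k → Set
  ClosedP {b} n (act A ts e) = ClosedTs n ts × ClosedE b n e
  ClosedP n (test φ) = ClosedF n φ
  ClosedP n (seq δ γ) = ClosedP n δ × ClosedP n γ
  ClosedP n (alt δ γ) = ClosedP n δ × ClosedP n γ
  ClosedP n (pi δ) = ClosedP (suc n) δ
  ClosedP n (star δ) = ClosedP n δ
  ClosedP n (conc δ γ) = ClosedP n δ × ClosedP n γ

  substF : ℕ → ℕ → Formula 0 → Formula 0
  substF n d ⊤f = ⊤f
  substF n d (fl F ts) = fl F (map (substT n d) ts)
  substF n d (eq t u) = eq (substT n d t) (substT n d u)
  substF n d (neg φ) = neg (substF n d φ)
  substF n d (and φ ψ) = and (substF n d φ) (substF n d ψ)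
  substF n d (ex φ) = ex (substF (suc n) d φ)
  substF n d (exR φ) = exR (substF (suc n) d φ)

  substE : ∀ b → ℕ → ℕ → Ext b 0 → Ext b 0
  substE true  n d t = substT n d t
  substE false n d t = t

  substP : ∀ {b} → ℕ → ℕ → Prog b 0 → Prog b 0
  substP {b} n d (act A ts e) = act A (map (substT n d) ts) (substE b n d e)
  substP n d (test φ) = test (substF n d φ)
  substP n d (seq δ γ) = seq (substP n d δ) (substP n d γ)
  substP n d (alt δ γ) = alt (substP n d δ) (substP n d γ)
  substP n d (pi δ) = pi (substP (suc n) d δ)
  substP n d (star δ) = star (substP n d δ)
  substP n d (conc δ γ) = conc (substP n d δ) (substP n d γ)

  instF : ∀ {k} → ℕ → Vec (Term 0) k → Formula k → Formula 0
  instF n ts ⊤f = ⊤f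
  instF n ts (fl F us) = fl F (map (instT n ts) us)
  instF n ts (eq t u) = eq (instT n ts t) (instT n ts u)
  instF n ts (neg φ) = neg (instF n ts φ)
  instF n ts (and φ ψ) = and (instF n ts φ) (instF n ts ψ)
  instF n ts (ex φ) = ex (instF (suc n) ts φ)
  instF n ts (exR φ) = exR (instF (suc n) ts φ)

  instE : ∀ b {k} → ℕ → Vec (Term 0) k → Ext b k → Ext b 0
  instE true  n ts t = instT n ts t
  instE false n ts t = tt

  instP : ∀ {b k} → ℕ → Vec (Term 0) k → Prog b k → Prog b 0
  instP {b} n ts (act A us e) = act A (map (instT n ts) us) (instE b n ts e)
  instP n ts (test φ) = test (instF n ts φ)
  instP n ts (seq δ γ) = seq (instP n ts δ) (instP n ts γ)
  instP n ts (alt δ γ) = alt (instP n ts δ) (instP n ts γ)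
  instP n ts (pi δ) = pi (instP (suc n) ts δ)
  instP n ts (star δ) = star (instP n ts δ)
  instP n ts (conc δ γ) = conc (instP n ts δ) (instP n ts γ)

  seqMap : ∀ {b} {X : Set} → (X → Prog b 0) → List X → Prog b 0
  seqMap f [] = nil
  seqMap f (x ∷ []) = f x
  seqMap f (x ∷ y ∷ r) = seq (f x) (seqMap f (y ∷ r))

  -- Basic action theory (axioms other than foundational / unique names /
  -- domain closure, which are built into the semantics below).
  -- Precondition axiom: Poss(A(x⃗,e),s) ≡ pre A (params x⃗,e)[s]
  -- Agent precondition: Poss_ag(A(x⃗),s) ≡ preAg A (params x⃗)[s]
  -- Successor state axioms, written per action type:
  --   F(y⃗, do(A(x⃗,e),s)) ≡ ssa F A (params y⃗,x⃗,e)[s]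
  -- Initial state axioms: a set of sentences evaluated at S0.
  record BAT : Set₁ where
    field
      pre   : (A : Fin nA) → Formula (suc (ar A))
      preAg : (A : Fin nA) → Formula (ar A)
      ssa   : (F : Fin nF) (A : Fin nA) → Formula (far F + suc (ar A))
      init  : Formula 0 → Set

-- Semantics: models of D ∪ C.  Reaction ⊆ Object is given by R.

module Sem (R : ℕ → Bool) (S : Sig) where
  open Sig S
  open Lang S

  -- action domain: A(d⃗, e) with e a Reaction (unique names + domain closure)
  Act : Set
  Act = Σ (Fin nA) λ A → Vec ℕ (ar A) × Σ ℕ λ e → T (R e)

  AgAct : Set
  AgAct = Σ (Fin nA) λ A → Vec ℕ (ar A)

  -- situations (foundational axioms): S0 = [], do(a,s) = a ∷ s
  Sit : Set
  Sit = List Act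

  State : Set₁
  State = (F : Fin nF) → Vec ℕ (far F) → Set

  record Model : Set₁ where
    field
      flu    : Sit → State
      poss   : Act → Sit → Set
      possAg : AgAct → Sit → Set
  open Model public

  Assign : Set
  Assign = ℕ → ℕ

  _,,_ : ℕ → Assign → Assign
  (d ,, v) zero = d
  (d ,, v) (suc i) = v i

  evT : ∀ {k} → Vec ℕ k → Assign → Term k → ℕ
  evT p v (var i) = v i
  evT p v (nm c)  = c
  evT p v (par j) = lookup p j

  ⟦_⟧ : ∀ {k} → Formula k → State → Vec ℕ k → Assign → Set
  ⟦ ⊤f ⟧ I p v = ⊤
  ⟦ fl F ts ⟧ I p v = I F (map (evT p v) ts)
  ⟦ eq t u ⟧ I p v = evT p v t ≡ evT p v u
  ⟦ neg φ ⟧ I p v = ¬ ⟦ φ ⟧ I p v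
  ⟦ and φ ψ ⟧ I p v = ⟦ φ ⟧ I p v × ⟦ ψ ⟧ I p v
  ⟦ ex φ ⟧ I p v = Σ ℕ λ d → ⟦ φ ⟧ I p (d ,, v)
  ⟦ exR φ ⟧ I p v = Σ ℕ λ d → T (R d) × ⟦ φ ⟧ I p (d ,, v)

  Holds : Model → Assign → Formula 0 → Sit → Set
  Holds M v φ s = ⟦ φ ⟧ (flu M s) [] v

  -- ConGolog Trans / Final (the unique interpretation fixed by C)
  module _ (M : Model) (v : Assign) where
    evs : ∀ {n} → Vec (Term 0) n → Vec ℕ n
    evs = map (evT [] v)

    data Final : {b : Bool} → Prog b 0 → Sit → Set

    data Trans : {b : Bool} → Prog b 0 → Sit → Prog b 0 → Sit → Set where
      tSys  : ∀ {A ts e s} (r : T (R (evT [] v e))) →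
              poss M (A , evs ts , evT [] v e , r) s →
              Trans {true} (act A ts e) s nil ((A , evs ts , evT [] v e , r) ∷ s)
      tAg   : ∀ {A ts s} (e : ℕ) (r : T (R e)) →
              poss M (A , evs ts , e , r) s →
              Trans {false} (act A ts tt) s nil ((A , evs ts , e , r) ∷ s)
      tSeq₁ : ∀ {b} {δ₁ δ₂ δ₁' : Prog b 0} {s s'} →
              Trans δ₁ s δ₁' s' → Trans (seq δ₁ δ₂) s (seq δ₁' δ₂) s'
      tSeq₂ : ∀ {b} {δ₁ δ₂ δ' : Prog b 0} {s s'} →
              Final δ₁ s → Trans δ₂ s δ' s' → Trans (seq δ₁ δ₂) s δ' s'
      tAlt₁ : ∀ {b} {δ₁ δ₂ δ' : Prog b 0} {s s'} →
              Trans δ₁ s δ' s' → Trans (alt δ₁ δ₂) s δ' s'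
      tAlt₂ : ∀ {b} {δ₁ δ₂ δ' : Prog b 0} {s s'} →
              Trans δ₂ s δ' s' → Trans (alt δ₁ δ₂) s δ' s'
      tPi   : ∀ {b} {δ δ' : Prog b 0} {s s'} (d : ℕ) →
              Trans (substP 0 d δ) s δ' s' → Trans (pi δ) s δ' s'
      tStar : ∀ {b} {δ δ'' : Prog b 0} {s s'} →
              Trans δ s δ'' s' → Trans (star δ) s (seq δ'' (star δ)) s'
      tConc₁ : ∀ {b} {δ₁ δ₂ δ₁' : Prog b 0} {s s'} →
              Trans δ₁ s δ₁' s' → Trans (conc δ₁ δ₂) s (conc δ₁' δ₂) s'
      tConc₂ : ∀ {b} {δ₁ δ₂ δ₂' : Prog b 0} {s s'} →
              Trans δ₂ s δ₂' s' → Trans (conc δ₁ δ₂) s (conc δ₁ δ₂') s'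

    data Final where
      fTest : ∀ {b} {φ s} → Holds M v φ s → Final {b} (test φ) s
      fSeq  : ∀ {b} {δ₁ δ₂ : Prog b 0} {s} → Final δ₁ s → Final δ₂ s → Final (seq δ₁ δ₂) s
      fAlt₁ : ∀ {b} {δ₁ δ₂ : Prog b 0} {s} → Final δ₁ s → Final (alt δ₁ δ₂) s
      fAlt₂ : ∀ {b} {δ₁ δ₂ : Prog b 0} {s} → Final δ₂ s → Final (alt δ₁ δ₂) s
      fPi   : ∀ {b} {δ : Prog b 0} {s} (d : ℕ) → Final (substP 0 d δ) s → Final (pi δ) s
      fStar : ∀ {b} {δ : Prog b 0} {s} → Final (star δ) s
      fConc : ∀ {b} {δ₁ δ₂ : Prog b 0} {s} → Final δ₁ s → Final δ₂ s → Final (conc δ₁ δ₂) s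

    data Trans* {b : Bool} : Prog b 0 → Sit → Prog b 0 → Sit → Set where
      ε   : ∀ {δ s} → Trans* δ s δ s
      _◅_ : ∀ {δ s δ' s' δ'' s''} → Trans δ s δ' s' → Trans* δ' s' δ'' s'' → Trans* δ s δ'' s''

    -- Do (system programs, b = true) and Do_ag (agent programs, b = false)
    Do : ∀ {b} → Prog b 0 → Sit → Sit → Set
    Do {b} δ s s' = Σ (Prog b 0) λ δ' → Trans* δ s δ' s' × Final δ' s'

    DoAgSeq : List (Σ (Fin nA) λ A → Vec (Term 0) (ar A)) → Sit → Sit → Set
    DoAgSeq [] s s' = s' ≡ s
    DoAgSeq ((A , ts) ∷ αs) s s' =
      Σ ℕ λ e → Σ (T (R e)) λ r →
        poss M (A , evs ts , e , r) s × DoAgSeq αs ((A , evs ts , e , r) ∷ s) s'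

  record IsModel (D : BAT) (M : Model) : Set where
    open BAT D
    field
      initial : ∀ φ → init φ → ∀ v → Holds M v φ []
      precond : ∀ A d e (r : T (R e)) s v →
                poss M (A , d , e , r) s ⇔ ⟦ pre A ⟧ (flu M s) (d ∷ʳ e) v
      precondAg : ∀ A d s v → possAg M (A , d) s ⇔ ⟦ preAg A ⟧ (flu M s) d v
      succState : ∀ F y A d e (r : T (R e)) s v →
                flu M ((A , d , e , r) ∷ s) F y ⇔ ⟦ ssa F A ⟧ (flu M s) (y ++ (d ∷ʳ e)) v

  record NDBAT : Set₁ where
    field
      bat   : BAT
      agNec : ∀ M → IsModel bat M → ∀ A d e (r : T (R e)) s →
              poss M (A , d , e , r) s → possAg M (A , d) s
      agSuf : ∀ M → IsModel bat M → ∀ A d s →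
              possAg M (A , d) s → Σ ℕ λ e → Σ (T (R e)) λ r → poss M (A , d , e , r) s
  open NDBAT public

module Abs (R : ℕ → Bool) (Sh Sl : Sig) where
  module H = Sig Sh
  module HL = Lang Sh
  module LL = Lang Sl
  module HS = Sem R Sh
  module LS = Sem R Sl

  -- m_a(A(x⃗)) has parameters x⃗; m_s(A(x⃗,e)) has parameters x⃗,e;
  -- m_f(F(x⃗)) has parameters x⃗.
  record RefMap : Set where
    field
      ma : (A : Fin H.nA) → LL.Prog false (H.ar A)
      ms : (A : Fin H.nA) → LL.Prog true (suc (H.ar A))
      mf : (F : Fin H.nF) → LL.Formula (H.far F)
      maClosed : ∀ A → LL.ClosedP 0 (ma A)
      msClosed : ∀ A → LL.ClosedP 0 (ms A)
      mfClosed : ∀ F → LL.ClosedF 0 (mf F)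

  module _ (m : RefMap) where
    open RefMap m

    maInst : (A : Fin H.nA) → Vec (Term 0) (H.ar A) → LL.Prog false 0
    maInst A ts = LL.instP 0 ts (ma A)

    msInst : (A : Fin H.nA) → Vec (Term 0) (H.ar A) → Term 0 → LL.Prog true 0
    msInst A ts e = LL.instP 0 (ts ∷ʳ e) (ms A)

    maSeq : List (Σ (Fin H.nA) λ A → Vec (Term 0) (H.ar A)) → LL.Prog false 0
    maSeq = LL.seqMap (λ { (A , ts) → maInst A ts })

    msSeq : List HS.Act → LL.Prog true 0
    msSeq = LL.seqMap (λ { (A , d , e , r) → msInst A (map nm d) (nm e) })

    mfF : HL.Formula 0 → LL.Formula 0
    mfF HL.⊤f = LL.⊤f
    mfF (HL.fl F ts) = LL.instF 0 ts (mf F)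
    mfF (HL.eq t u) = LL.eq t u
    mfF (HL.neg φ) = LL.neg (mfF φ)
    mfF (HL.and φ ψ) = LL.and (mfF φ) (mfF ψ)
    mfF (HL.ex φ) = LL.ex (mfF φ)
    mfF (HL.exR φ) = LL.exR (mfF φ)

    SD : LS.NDBAT → ∀ {b} → LL.Prog b 0 → Set₁
    SD Dl δ = ∀ M → LS.IsModel (LS.bat Dl) M → ∀ v s δ' δ'' s' →
              LS.Trans* M v δ s δ' s' → LS.Trans* M v δ s δ'' s' → δ' ≡ δ''

    IsRefMap : LS.NDBAT → Set₁
    IsRefMap Dl = (∀ A (d : Vec ℕ (H.ar A)) → SD Dl (maInst A (map nm d)))
                × (∀ A (d : Vec ℕ (H.ar A)) e → T (R e) → SD Dl (msInst A (map nm d) (nm e)))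

    Proper : LS.NDBAT → Set₁
    Proper Dl = ∀ M → LS.IsModel (LS.bat Dl) M → ∀ v (αs : List HS.Act) s →
      LS.Do M v (msSeq αs) [] s →
      ∀ A (d : Vec ℕ (H.ar A)) s' →
        LS.Do M v (maInst A (map nm d)) s s'
        ⇔ (Σ ℕ λ e → T (R e) × LS.Do M v (msInst A (map nm d) (nm e)) s s')

    record IsBisim (Mh : HS.Model) (Ml : LS.Model) (B : HS.Sit → LS.Sit → Set) : Set₁ where
      field
        harm : ∀ {sh sl} → B sh sl → ∀ (v : LS.Assign) F (d : Vec ℕ (H.far F)) →
               HS.flu Mh sh F d ⇔ LS.⟦ mf F ⟧ (LS.flu Ml sl) d v
        forth : ∀ {sh sl} → B sh sl → ∀ v A (d : Vec ℕ (H.ar A)) e (r : T (R e)) →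
               HS.poss Mh (A , d , e , r) sh →
               Σ LS.Sit λ sl' → LS.Do Ml v (msInst A (map nm d) (nm e)) sl sl'
                                × B ((A , d , e , r) ∷ sh) sl'
        back : ∀ {sh sl} → B sh sl → ∀ v A (d : Vec ℕ (H.ar A)) e (r : T (R e)) sl' →
               LS.Do Ml v (msInst A (map nm d) (nm e)) sl sl' →
               HS.poss Mh (A , d , e , r) sh × B ((A , d , e , r) ∷ sh) sl'

    Bisimilar : HS.Model → LS.Model → Set₁
    Bisimilar Mh Ml = Σ (HS.Sit → LS.Sit → Set) λ B → IsBisim Mh Ml B × B [] []

-- Both directions are proved by induction on α⃗, moving through the
-- bisimulation in lockstep.  A low-level run of m_a(A(t⃗)) from a situation
-- reached by some m_s(β⃗) is, by properness, a run of m_s(A(d⃗,e)) for some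
-- reaction e, where d⃗ are the values of t⃗; the bisimulation matches it with
-- a possible high-level step A(d⃗,e), and conversely.  Properness speaks only
-- about ground parameters, so one first shows that replacing the free
-- variables of a program by the names of their values preserves its
-- executions.  Finally, bisimilar situations satisfy φ and m_f(φ) alike.

module Submission where

open import Defs
open import Data.Nat using (ℕ; zero; suc; _+_; _<ᵇ_; _≡ᵇ_)
open import Data.Bool using (Bool; true; false; T)
open import Data.Fin using (Fin)
open import Data.Vec using (Vec; []; _∷_; map)
open import Data.Vec.Properties using (lookup-map; map-∘; map-cong)
open import Data.Vec.Relation.Binary.Pointwise.Inductive as Pointwise
  using (Pointwise; []; _∷_; Pointwise-≡⇒≡)
open import Data.List using (List; []; _∷_; _++_)
open import Data.Product using (Σ; _×_; _,_)
open import Data.Product.Function.NonDependent.Propositional using (_×-⇔_)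
open import Data.Product.Function.Dependent.Propositional using (Σ-⇔)
open import Data.Unit using (⊤; tt)
open import Level using (0ℓ)
open import Function.Bundles using (_⇔_; mk⇔; Equivalence)
open import Function.Construct.Identity using (↠-id)
open import Function.Related.Propositional using (K-reflexive)
open import Function.Related.TypeIsomorphisms using (¬-cong-⇔)
import Function.Properties.Equivalence as ⇔
import Relation.Binary.Reasoning.Setoid as SetoidReasoning
open import Relation.Binary.PropositionalEquality using (_≡_; refl; sym; cong; cong₂; module ≡-Reasoning)
open import Function.Base using (_∘_)

suc-n+i<ᵇn≡false : ∀ n i → (suc n + i <ᵇ n) ≡ false
suc-n+i<ᵇn≡false zero    i = refl
suc-n+i<ᵇn≡false (suc n) i = suc-n+i<ᵇn≡false n i

suc-n+i≡ᵇn≡false : ∀ n i → (suc n + i ≡ᵇ n) ≡ false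
suc-n+i≡ᵇn≡false zero    i = refl
suc-n+i≡ᵇn≡false (suc n) i = suc-n+i≡ᵇn≡false n i

substT-free : ∀ n d i → substT n d (var (suc n + i)) ≡ var (n + i)
substT-free n d i rewrite suc-n+i<ᵇn≡false n i | suc-n+i≡ᵇn≡false n i = refl

-- Under m binders the variable free at index i is var (m + i); ValueEqT v m
-- relates a term to itself and such a variable to the name of its value v i.
data ValueEqT (v : ℕ → ℕ) (m : ℕ) : Term 0 → Term 0 → Set where
  same   : ∀ {t} → ValueEqT v m t t
  var≈nm : ∀ i → ValueEqT v m (var (m + i)) (nm (v i))
  nm≈var : ∀ i → ValueEqT v m (nm (v i)) (var (m + i))

module _ {v : ℕ → ℕ} where

  ValueEqT-sym : ∀ {m t u} → ValueEqT v m t u → ValueEqT v m u t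
  ValueEqT-sym same       = same
  ValueEqT-sym (var≈nm i) = nm≈var i
  ValueEqT-sym (nm≈var i) = var≈nm i

  ValueEqT-substT : ∀ {n} d {t u} → ValueEqT v (suc n) t u →
                    ValueEqT v n (substT n d t) (substT n d u)
  ValueEqT-substT d same = same
  ValueEqT-substT {n} d (var≈nm i) rewrite substT-free n d i = var≈nm i
  ValueEqT-substT {n} d (nm≈var i) rewrite substT-free n d i = nm≈var i

  ValueEqT-liftT : ∀ n {t u} → ValueEqT v 0 t u → ValueEqT v n (liftT n t) (liftT n u)
  ValueEqT-liftT n same       = same
  ValueEqT-liftT n (var≈nm i) = var≈nm i
  ValueEqT-liftT n (nm≈var i) = nm≈var i

module ValueEqSyntax (S : Sig) (v : ℕ → ℕ) where
  open Lang S

  data ValueEqF : ℕ → Formula 0 → Formula 0 → Set where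
    ⊤f  : ∀ {m} → ValueEqF m ⊤f ⊤f
    fl  : ∀ {m F ts us} → Pointwise (ValueEqT v m) ts us → ValueEqF m (fl F ts) (fl F us)
    eq  : ∀ {m t t′ u u′} → ValueEqT v m t t′ → ValueEqT v m u u′ → ValueEqF m (eq t u) (eq t′ u′)
    neg : ∀ {m φ ψ} → ValueEqF m φ ψ → ValueEqF m (neg φ) (neg ψ)
    and : ∀ {m φ φ′ ψ ψ′} → ValueEqF m φ φ′ → ValueEqF m ψ ψ′ → ValueEqF m (and φ ψ) (and φ′ ψ′)
    ex  : ∀ {m φ ψ} → ValueEqF (suc m) φ ψ → ValueEqF m (ex φ) (ex ψ)
    exR : ∀ {m φ ψ} → ValueEqF (suc m) φ ψ → ValueEqF m (exR φ) (exR ψ)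

  ValueEqE : ∀ b → ℕ → Ext b 0 → Ext b 0 → Set
  ValueEqE true  m e e′ = ValueEqT v m e e′
  ValueEqE false m _ _  = ⊤

  data ValueEqP {b : Bool} : ℕ → Prog b 0 → Prog b 0 → Set where
    act  : ∀ {m A ts us e e′} → Pointwise (ValueEqT v m) ts us → ValueEqE b m e e′ →
           ValueEqP m (act A ts e) (act A us e′)
    test : ∀ {m φ ψ} → ValueEqF m φ ψ → ValueEqP m (test φ) (test ψ)
    seq  : ∀ {m δ δ′ γ γ′} → ValueEqP m δ δ′ → ValueEqP m γ γ′ → ValueEqP m (seq δ γ) (seq δ′ γ′)
    alt  : ∀ {m δ δ′ γ γ′} → ValueEqP m δ δ′ → ValueEqP m γ γ′ → ValueEqP m (alt δ γ) (alt δ′ γ′)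
    pi   : ∀ {m δ δ′} → ValueEqP (suc m) δ δ′ → ValueEqP m (pi δ) (pi δ′)
    star : ∀ {m δ δ′} → ValueEqP m δ δ′ → ValueEqP m (star δ) (star δ′)
    conc : ∀ {m δ δ′ γ γ′} → ValueEqP m δ δ′ → ValueEqP m γ γ′ → ValueEqP m (conc δ γ) (conc δ′ γ′)

  ValueEqF-sym : ∀ {m φ ψ} → ValueEqF m φ ψ → ValueEqF m ψ φ
  ValueEqF-sym ⊤f        = ⊤f
  ValueEqF-sym (fl ps)   = fl (Pointwise.sym ValueEqT-sym ps)
  ValueEqF-sym (eq p q)  = eq (ValueEqT-sym p) (ValueEqT-sym q)
  ValueEqF-sym (neg p)   = neg (ValueEqF-sym p)
  ValueEqF-sym (and p q) = and (ValueEqF-sym p) (ValueEqF-sym q)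
  ValueEqF-sym (ex p)    = ex (ValueEqF-sym p)
  ValueEqF-sym (exR p)   = exR (ValueEqF-sym p)

  ValueEqE-sym : ∀ b {m e e′} → ValueEqE b m e e′ → ValueEqE b m e′ e
  ValueEqE-sym true  p = ValueEqT-sym p
  ValueEqE-sym false _ = tt

  ValueEqP-sym : ∀ {b m} {δ γ : Prog b 0} → ValueEqP m δ γ → ValueEqP m γ δ
  ValueEqP-sym {b} (act ps p) = act (Pointwise.sym ValueEqT-sym ps) (ValueEqE-sym b p)
  ValueEqP-sym (test p)   = test (ValueEqF-sym p)
  ValueEqP-sym (seq p q)  = seq (ValueEqP-sym p) (ValueEqP-sym q)
  ValueEqP-sym (alt p q)  = alt (ValueEqP-sym p) (ValueEqP-sym q)
  ValueEqP-sym (pi p)     = pi (ValueEqP-sym p)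
  ValueEqP-sym (star p)   = star (ValueEqP-sym p)
  ValueEqP-sym (conc p q) = conc (ValueEqP-sym p) (ValueEqP-sym q)

  ValueEqF-substF : ∀ {n} d {φ ψ} → ValueEqF (suc n) φ ψ →
                    ValueEqF n (substF n d φ) (substF n d ψ)
  ValueEqF-substF d ⊤f        = ⊤f
  ValueEqF-substF d (fl ps)   = fl (Pointwise.map⁺ (ValueEqT-substT d) ps)
  ValueEqF-substF d (eq p q)  = eq (ValueEqT-substT d p) (ValueEqT-substT d q)
  ValueEqF-substF d (neg p)   = neg (ValueEqF-substF d p)
  ValueEqF-substF d (and p q) = and (ValueEqF-substF d p) (ValueEqF-substF d q)
  ValueEqF-substF d (ex p)    = ex (ValueEqF-substF d p)
  ValueEqF-substF d (exR p)   = exR (ValueEqF-substF d p)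

  ValueEqE-substE : ∀ b {n} d {e e′} → ValueEqE b (suc n) e e′ →
                    ValueEqE b n (substE b n d e) (substE b n d e′)
  ValueEqE-substE true  d p = ValueEqT-substT d p
  ValueEqE-substE false d _ = tt

  ValueEqP-substP : ∀ {b n} d {δ γ : Prog b 0} → ValueEqP (suc n) δ γ →
                    ValueEqP n (substP n d δ) (substP n d γ)
  ValueEqP-substP {b} d (act ps p) = act (Pointwise.map⁺ (ValueEqT-substT d) ps) (ValueEqE-substE b d p)
  ValueEqP-substP d (test p)   = test (ValueEqF-substF d p)
  ValueEqP-substP d (seq p q)  = seq (ValueEqP-substP d p) (ValueEqP-substP d q)
  ValueEqP-substP d (alt p q)  = alt (ValueEqP-substP d p) (ValueEqP-substP d q)
  ValueEqP-substP d (pi p)     = pi (ValueEqP-substP d p)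
  ValueEqP-substP d (star p)   = star (ValueEqP-substP d p)
  ValueEqP-substP d (conc p q) = conc (ValueEqP-substP d p) (ValueEqP-substP d q)

  module _ {k} {ts us : Vec (Term 0) k} (ts≈us : Pointwise (ValueEqT v 0) ts us) where

    ValueEqT-instT : ∀ n (t : Term k) → ValueEqT v n (instT n ts t) (instT n us t)
    ValueEqT-instT n (var i) = same
    ValueEqT-instT n (nm c)  = same
    ValueEqT-instT n (par j) = ValueEqT-liftT n (Pointwise.lookup ts≈us j)

    ValueEqTs-instT : ∀ {p} n (ws : Vec (Term k) p) →
                      Pointwise (ValueEqT v n) (map (instT n ts) ws) (map (instT n us) ws)
    ValueEqTs-instT n []       = []
    ValueEqTs-instT n (w ∷ ws) = ValueEqT-instT n w ∷ ValueEqTs-instT n ws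

    ValueEqF-instF : ∀ n (φ : Formula k) → ValueEqF n (instF n ts φ) (instF n us φ)
    ValueEqF-instF n ⊤f        = ⊤f
    ValueEqF-instF n (fl F ws) = fl (ValueEqTs-instT n ws)
    ValueEqF-instF n (eq t u)  = eq (ValueEqT-instT n t) (ValueEqT-instT n u)
    ValueEqF-instF n (neg φ)   = neg (ValueEqF-instF n φ)
    ValueEqF-instF n (and φ ψ) = and (ValueEqF-instF n φ) (ValueEqF-instF n ψ)
    ValueEqF-instF n (ex φ)    = ex (ValueEqF-instF (suc n) φ)
    ValueEqF-instF n (exR φ)   = exR (ValueEqF-instF (suc n) φ)

    ValueEqE-instE : ∀ b n (e : Ext b k) → ValueEqE b n (instE b n ts e) (instE b n us e)
    ValueEqE-instE true  n e = ValueEqT-instT n e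
    ValueEqE-instE false n _ = tt

    ValueEqP-instP : ∀ {b} n (δ : Prog b k) → ValueEqP n (instP n ts δ) (instP n us δ)
    ValueEqP-instP {b} n (act A ws e) = act (ValueEqTs-instT n ws) (ValueEqE-instE b n e)
    ValueEqP-instP n (test φ)   = test (ValueEqF-instF n φ)
    ValueEqP-instP n (seq δ γ)  = seq (ValueEqP-instP n δ) (ValueEqP-instP n γ)
    ValueEqP-instP n (alt δ γ)  = alt (ValueEqP-instP n δ) (ValueEqP-instP n γ)
    ValueEqP-instP n (pi δ)     = pi (ValueEqP-instP (suc n) δ)
    ValueEqP-instP n (star δ)   = star (ValueEqP-instP n δ)
    ValueEqP-instP n (conc δ γ) = conc (ValueEqP-instP n δ) (ValueEqP-instP n γ)

module ValueEqSemantics (R : ℕ → Bool) (S : Sig) (v : ℕ → ℕ) where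
  open Lang S
  open Sem R S
  open ValueEqSyntax S v

  ValueEqT-name : (t : Term 0) → ValueEqT v 0 t (nm (evT [] v t))
  ValueEqT-name (var i) = var≈nm i
  ValueEqT-name (nm c)  = same

  ValueEqTs-names : ∀ {k} (ts : Vec (Term 0) k) →
                    Pointwise (ValueEqT v 0) ts (map nm (map (evT [] v) ts))
  ValueEqTs-names []       = []
  ValueEqTs-names (t ∷ ts) = ValueEqT-name t ∷ ValueEqTs-names ts

  module _ {m} {w : Assign} (w≡v : ∀ i → w (m + i) ≡ v i) where

    evT-ValueEqT : ∀ {t u} → ValueEqT v m t u → evT [] w t ≡ evT [] w u
    evT-ValueEqT same       = refl
    evT-ValueEqT (var≈nm i) = w≡v i
    evT-ValueEqT (nm≈var i) = sym (w≡v i)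

    evTs-ValueEqT : ∀ {k} {ts us : Vec (Term 0) k} → Pointwise (ValueEqT v m) ts us →
                    map (evT [] w) ts ≡ map (evT [] w) us
    evTs-ValueEqT ps = Pointwise-≡⇒≡ (Pointwise.map⁺ evT-ValueEqT ps)

  ⟦⟧-ValueEqF : ∀ {m} I {w : Assign} → (∀ i → w (m + i) ≡ v i) →
                ∀ {φ ψ} → ValueEqF m φ ψ → ⟦ φ ⟧ I [] w ⇔ ⟦ ψ ⟧ I [] w
  ⟦⟧-ValueEqF I w≡v ⊤f              = ⇔.refl
  ⟦⟧-ValueEqF I w≡v (fl {F = F} ps) = K-reflexive (cong (I F) (evTs-ValueEqT w≡v ps))
  ⟦⟧-ValueEqF I w≡v (eq p q)        = K-reflexive (cong₂ _≡_ (evT-ValueEqT w≡v p) (evT-ValueEqT w≡v q))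
  ⟦⟧-ValueEqF I w≡v (neg p)         = ¬-cong-⇔ (⟦⟧-ValueEqF I w≡v p)
  ⟦⟧-ValueEqF I w≡v (and p q)       = ⟦⟧-ValueEqF I w≡v p ×-⇔ ⟦⟧-ValueEqF I w≡v q
  ⟦⟧-ValueEqF I w≡v (ex p)          = Σ-⇔ (↠-id ℕ) (⟦⟧-ValueEqF I w≡v p)
  ⟦⟧-ValueEqF I w≡v (exR p)         = Σ-⇔ (↠-id ℕ) (⇔.refl ×-⇔ ⟦⟧-ValueEqF I w≡v p)

  module _ (M : Model) where

    tSys-≡ : ∀ {A ts e s d x} (r : T (R x)) → evs M v ts ≡ d → evT [] v e ≡ x →
             poss M (A , d , x , r) s → Trans M v {true} (act A ts e) s nil ((A , d , x , r) ∷ s)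
    tSys-≡ r refl refl p = tSys r p

    tAg-≡ : ∀ {A ts s d} {e′ : ⊤} e (r : T (R e)) → evs M v ts ≡ d →
            poss M (A , d , e , r) s → Trans M v {false} (act A ts e′) s nil ((A , d , e , r) ∷ s)
    tAg-≡ e r refl p = tAg e r p

    Final-ValueEqP : ∀ {b} {δ γ : Prog b 0} {s} → ValueEqP 0 δ γ → Final M v δ s → Final M v γ s
    Final-ValueEqP (test p)   (fTest h)     = fTest (Equivalence.to (⟦⟧-ValueEqF _ (λ _ → refl) p) h)
    Final-ValueEqP (seq p q)  (fSeq f g)    = fSeq (Final-ValueEqP p f) (Final-ValueEqP q g)
    Final-ValueEqP (alt p q)  (fAlt₁ f)     = fAlt₁ (Final-ValueEqP p f)
    Final-ValueEqP (alt p q)  (fAlt₂ g)     = fAlt₂ (Final-ValueEqP q g)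
    Final-ValueEqP (pi p)     (fPi d f)     = fPi d (Final-ValueEqP (ValueEqP-substP d p) f)
    Final-ValueEqP (star p)   fStar         = fStar
    Final-ValueEqP (conc p q) (fConc f g)   = fConc (Final-ValueEqP p f) (Final-ValueEqP q g)

    Trans-ValueEqP : ∀ {b} {δ γ δ′ : Prog b 0} {s s′} → ValueEqP 0 δ γ → Trans M v δ s δ′ s′ →
                     Σ (Prog b 0) λ γ′ → Trans M v γ s γ′ s′ × ValueEqP 0 δ′ γ′
    Trans-ValueEqP (act ps p) (tSys r poss) =
      nil , tSys-≡ r (sym (evTs-ValueEqT (λ _ → refl) ps)) (sym (evT-ValueEqT (λ _ → refl) p)) poss , test ⊤f
    Trans-ValueEqP (act ps _) (tAg e r poss) =
      nil , tAg-≡ e r (sym (evTs-ValueEqT (λ _ → refl) ps)) poss , test ⊤f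
    Trans-ValueEqP (seq p q) (tSeq₁ t) with Trans-ValueEqP p t
    ... | γ′ , t′ , p′ = seq γ′ _ , tSeq₁ t′ , seq p′ q
    Trans-ValueEqP (seq p q) (tSeq₂ f t) with Trans-ValueEqP q t
    ... | γ′ , t′ , q′ = γ′ , tSeq₂ (Final-ValueEqP p f) t′ , q′
    Trans-ValueEqP (alt p q) (tAlt₁ t) with Trans-ValueEqP p t
    ... | γ′ , t′ , p′ = γ′ , tAlt₁ t′ , p′
    Trans-ValueEqP (alt p q) (tAlt₂ t) with Trans-ValueEqP q t
    ... | γ′ , t′ , q′ = γ′ , tAlt₂ t′ , q′
    Trans-ValueEqP (pi p) (tPi d t) with Trans-ValueEqP (ValueEqP-substP d p) t
    ... | γ′ , t′ , p′ = γ′ , tPi d t′ , p′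
    Trans-ValueEqP (star p) (tStar t) with Trans-ValueEqP p t
    ... | γ′ , t′ , p′ = seq γ′ _ , tStar t′ , seq p′ (star p)
    Trans-ValueEqP (conc p q) (tConc₁ t) with Trans-ValueEqP p t
    ... | γ′ , t′ , p′ = conc γ′ _ , tConc₁ t′ , conc p′ q
    Trans-ValueEqP (conc p q) (tConc₂ t) with Trans-ValueEqP q t
    ... | γ′ , t′ , q′ = conc _ γ′ , tConc₂ t′ , conc p q′

    Trans*-ValueEqP : ∀ {b} {δ γ δ′ : Prog b 0} {s s′} → ValueEqP 0 δ γ → Trans* M v δ s δ′ s′ →
                      Σ (Prog b 0) λ γ′ → Trans* M v γ s γ′ s′ × ValueEqP 0 δ′ γ′
    Trans*-ValueEqP p ε = _ , ε , p
    Trans*-ValueEqP p (t ◅ ts) with Trans-ValueEqP p t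
    ... | _ , t′ , p₁ with Trans*-ValueEqP p₁ ts
    ... | γ′ , ts′ , p′ = γ′ , t′ ◅ ts′ , p′

    Do-ValueEqP : ∀ {b} {δ γ : Prog b 0} {s s′} → ValueEqP 0 δ γ → Do M v δ s s′ → Do M v γ s s′
    Do-ValueEqP p (_ , ts , f) with Trans*-ValueEqP p ts
    ... | γ′ , ts′ , p′ = γ′ , ts′ , Final-ValueEqP p′ f

    Do-ValueEqP-⇔ : ∀ {b} {δ γ : Prog b 0} {s s′} → ValueEqP 0 δ γ → Do M v δ s s′ ⇔ Do M v γ s s′
    Do-ValueEqP-⇔ p = mk⇔ (Do-ValueEqP p) (Do-ValueEqP (ValueEqP-sym p))

module NameInstantiation (R : ℕ → Bool) (S : Sig) where
  open Lang S
  open Sem R S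

  evT-instT-names : ∀ {k} n (d : Vec ℕ k) w (t : Term k) → evT [] w (instT n (map nm d) t) ≡ evT d w t
  evT-instT-names n d w (var i) = refl
  evT-instT-names n d w (nm c)  = refl
  evT-instT-names n d w (par j) rewrite lookup-map j (nm {0}) d = refl

  ⟦instF-names⟧ : ∀ {k} n (d : Vec ℕ k) I w (φ : Formula k) →
                  ⟦ instF n (map nm d) φ ⟧ I [] w ⇔ ⟦ φ ⟧ I d w
  ⟦instF-names⟧ n d I w ⊤f        = ⇔.refl
  ⟦instF-names⟧ n d I w (fl F us) = K-reflexive (cong (I F) (begin
    map (evT [] w) (map (instT n (map nm d)) us)  ≡⟨ map-∘ (evT [] w) (instT n (map nm d)) us ⟨
    map (evT [] w ∘ instT n (map nm d)) us        ≡⟨ map-cong (evT-instT-names n d w) us ⟩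
    map (evT d w) us                              ∎))
    where open ≡-Reasoning
  ⟦instF-names⟧ n d I w (eq t u)  =
    K-reflexive (cong₂ _≡_ (evT-instT-names n d w t) (evT-instT-names n d w u))
  ⟦instF-names⟧ n d I w (neg φ)   = ¬-cong-⇔ (⟦instF-names⟧ n d I w φ)
  ⟦instF-names⟧ n d I w (and φ ψ) = ⟦instF-names⟧ n d I w φ ×-⇔ ⟦instF-names⟧ n d I w ψ
  ⟦instF-names⟧ n d I w (ex φ)    = Σ-⇔ (↠-id ℕ) λ {e} → ⟦instF-names⟧ (suc n) d I (e ,, w) φ
  ⟦instF-names⟧ n d I w (exR φ)   =
    Σ-⇔ (↠-id ℕ) λ {e} → ⇔.refl ×-⇔ ⟦instF-names⟧ (suc n) d I (e ,, w) φ

module Sequencing (R : ℕ → Bool) (S : Sig) (M : Sem.Model R S) (v : ℕ → ℕ) where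
  open Lang S
  open Sem R S

  Do-nil : ∀ {b s} → Do M v {b} nil s s
  Do-nil = nil , ε , fTest tt

  Do-nil⁻ : ∀ {b s s′} → Do M v {b} nil s s′ → s′ ≡ s
  Do-nil⁻ (_ , ε , _)     = refl
  Do-nil⁻ (_ , () ◅ _ , _)

  _◅◅_ : ∀ {b} {δ δ′ δ″ : Prog b 0} {s s′ s″} →
         Trans* M v δ s δ′ s′ → Trans* M v δ′ s′ δ″ s″ → Trans* M v δ s δ″ s″
  ε        ◅◅ ts′ = ts′
  (t ◅ ts) ◅◅ ts′ = t ◅ (ts ◅◅ ts′)

  Trans*-seqˡ : ∀ {b} {δ₁ δ₁′ δ₂ : Prog b 0} {s s′} →
                Trans* M v δ₁ s δ₁′ s′ → Trans* M v (seq δ₁ δ₂) s (seq δ₁′ δ₂) s′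
  Trans*-seqˡ ε        = ε
  Trans*-seqˡ (t ◅ ts) = tSeq₁ t ◅ Trans*-seqˡ ts

  Do-seq⁺ : ∀ {b} {δ₁ δ₂ : Prog b 0} {s s′ s″} →
            Do M v δ₁ s s′ → Do M v δ₂ s′ s″ → Do M v (seq δ₁ δ₂) s s″
  Do-seq⁺ (δ₁′ , ts₁ , f₁) (δ₂′ , ε , f₂)        = seq δ₁′ δ₂′ , Trans*-seqˡ ts₁ , fSeq f₁ f₂
  Do-seq⁺ (δ₁′ , ts₁ , f₁) (δ₂′ , t ◅ ts₂ , f₂) = δ₂′ , Trans*-seqˡ ts₁ ◅◅ (tSeq₂ f₁ t ◅ ts₂) , f₂

  Trans*-seq⁻ : ∀ {b} {δ₁ δ₂ δ′ : Prog b 0} {s s″} →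
                Trans* M v (seq δ₁ δ₂) s δ′ s″ → Final M v δ′ s″ →
                Σ Sit λ s′ → Do M v δ₁ s s′ × Do M v δ₂ s′ s″
  Trans*-seq⁻ ε                  (fSeq f₁ f₂) = _ , (_ , ε , f₁) , (_ , ε , f₂)
  Trans*-seq⁻ (tSeq₁ t  ◅ ts) f with Trans*-seq⁻ ts f
  ... | s′ , (δ₁′ , ts₁ , f₁) , run₂ = s′ , (δ₁′ , t ◅ ts₁ , f₁) , run₂
  Trans*-seq⁻ (tSeq₂ f₁ t ◅ ts) f = _ , (_ , ε , f₁) , (_ , t ◅ ts , f)

  module _ {b} {X : Set} (f : X → Prog b 0) where

    Do-seqMap-∷⁺ : ∀ x xs {s s′ s″} → Do M v (f x) s s′ → Do M v (seqMap f xs) s′ s″ →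
                   Do M v (seqMap f (x ∷ xs)) s s″
    Do-seqMap-∷⁺ x []      run₁ run₂ with Do-nil⁻ run₂
    ... | refl = run₁
    Do-seqMap-∷⁺ x (_ ∷ _) run₁ run₂ = Do-seq⁺ run₁ run₂

    Do-seqMap-∷⁻ : ∀ x xs {s s″} → Do M v (seqMap f (x ∷ xs)) s s″ →
                   Σ Sit λ s′ → Do M v (f x) s s′ × Do M v (seqMap f xs) s′ s″
    Do-seqMap-∷⁻ x []      run          = _ , run , Do-nil
    Do-seqMap-∷⁻ x (_ ∷ _) (_ , ts , f) = Trans*-seq⁻ ts f

    Do-seqMap-++⁺ : ∀ xs ys {s s′ s″} → Do M v (seqMap f xs) s s′ → Do M v (seqMap f ys) s′ s″ →
                    Do M v (seqMap f (xs ++ ys)) s s″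
    Do-seqMap-++⁺ []       ys run₁ run₂ with Do-nil⁻ run₁
    ... | refl = run₂
    Do-seqMap-++⁺ (x ∷ xs) ys run₁ run₂ with Do-seqMap-∷⁻ x xs run₁
    ... | _ , runₓ , runₓₛ = Do-seqMap-∷⁺ x (xs ++ ys) runₓ (Do-seqMap-++⁺ xs ys runₓₛ run₂)

module Refinement (R : ℕ → Bool) (Sh Sl : Sig) (m : Abs.RefMap R Sh Sl) where
  open Abs R Sh Sl
  open RefMap m

  evT-cross : ∀ {wh wl} → (∀ i → wh i ≡ wl i) → (t : Term 0) → HS.evT [] wh t ≡ LS.evT [] wl t
  evT-cross wh≡wl (var i) = wh≡wl i
  evT-cross wh≡wl (nm c)  = refl

  ,,-cross : ∀ {wh wl} → (∀ i → wh i ≡ wl i) → ∀ d i → (d HS.,, wh) i ≡ (d LS.,, wl) i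
  ,,-cross wh≡wl d zero    = refl
  ,,-cross wh≡wl d (suc i) = wh≡wl i

  module Bisimulation (Mh : HS.Model) (Ml : LS.Model) (B : HS.Sit → LS.Sit → Set) (isB : IsBisim m Mh Ml B) where
    open IsBisim isB

    mfF-sound : ∀ {sh sl} → B sh sl → ∀ φ {wh wl} → (∀ i → wh i ≡ wl i) →
                HS.⟦ φ ⟧ (HS.flu Mh sh) [] wh ⇔ LS.⟦ mfF m φ ⟧ (LS.flu Ml sl) [] wl
    mfF-sound b HL.⊤f        wh≡wl = ⇔.refl
    mfF-sound {sh} {sl} b (HL.fl F ts) {wh} {wl} wh≡wl = begin
      HS.flu Mh sh F d                                  ≈⟨ harm b wl F d ⟩
      LS.⟦ mf F ⟧ I d wl                                ≈⟨ NameInstantiation.⟦instF-names⟧ R Sl 0 d I wl (mf F) ⟨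
      LS.⟦ LL.instF 0 (map nm d) (mf F) ⟧ I [] wl       ≈⟨ ValueEqSemantics.⟦⟧-ValueEqF R Sl wh I (λ i → sym (wh≡wl i))
                                                             (ValueEqSyntax.ValueEqF-instF Sl wh
                                                               (ValueEqSemantics.ValueEqTs-names R Sh wh ts) 0 (mf F)) ⟨
      LS.⟦ LL.instF 0 ts (mf F) ⟧ I [] wl               ∎
      where
        open SetoidReasoning (⇔.⇔-setoid 0ℓ)
        d : Vec ℕ (H.far F)
        d = map (HS.evT [] wh) ts
        I : LS.State
        I = LS.flu Ml sl
    mfF-sound b (HL.eq t u)  wh≡wl = K-reflexive (cong₂ _≡_ (evT-cross wh≡wl t) (evT-cross wh≡wl u))
    mfF-sound b (HL.neg φ)   wh≡wl = ¬-cong-⇔ (mfF-sound b φ wh≡wl)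
    mfF-sound b (HL.and φ ψ) wh≡wl = mfF-sound b φ wh≡wl ×-⇔ mfF-sound b ψ wh≡wl
    mfF-sound b (HL.ex φ)    wh≡wl = Σ-⇔ (↠-id ℕ) λ {d} → mfF-sound b φ (,,-cross wh≡wl d)
    mfF-sound b (HL.exR φ)   wh≡wl = Σ-⇔ (↠-id ℕ) λ {d} → ⇔.refl ×-⇔ mfF-sound b φ (,,-cross wh≡wl d)

    module Runs (Dl : LS.NDBAT) (proper : Proper m Dl) (isMl : LS.IsModel (LS.bat Dl) Ml) (v : ℕ → ℕ) where
      open Sequencing R Sl Ml v

      -- Properness only speaks about situations reached by some m_s(α⃗) from S₀,
      -- so every low-level run below carries such a history.
      Reachable : LS.Sit → Set
      Reachable sl = Σ (List HS.Act) λ αs → LS.Do Ml v (msSeq m αs) [] sl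

      Reachable-step : ∀ {A d e sl sl′} (r : T (R e)) → Reachable sl →
                       LS.Do Ml v (msInst m A (map nm d) (nm e)) sl sl′ → Reachable sl′
      Reachable-step {A} {d} {e} r (αs , run) runA =
        αs ++ (A , d , e , r) ∷ [] , Do-seqMap-++⁺ _ αs _ run runA

      values : ∀ {k} → Vec (Term 0) k → Vec ℕ k
      values = map (HS.evT [] v)

      maInst-proper : ∀ {sl} → Reachable sl → ∀ A ts {sl′} →
                      LS.Do Ml v (maInst m A ts) sl sl′ ⇔
                      (Σ ℕ λ e → T (R e) × LS.Do Ml v (msInst m A (map nm (values ts)) (nm e)) sl sl′)
      maInst-proper (αs , run) A ts = ⇔.trans
        (ValueEqSemantics.Do-ValueEqP-⇔ R Sl v Ml
          (ValueEqSyntax.ValueEqP-instP Sl v (ValueEqSemantics.ValueEqTs-names R Sh v ts) 0 (ma A)))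
        (proper Ml isMl v αs _ run A (values ts) _)

      lowRun⇒highRun : ∀ φ αs {sh sl sl′} → B sh sl → Reachable sl →
                       LS.Do Ml v (maSeq m αs) sl sl′ → LS.Holds Ml v (mfF m φ) sl′ →
                       Σ HS.Sit λ sh′ → HS.DoAgSeq Mh v αs sh sh′ × HS.Holds Mh v φ sh′
      lowRun⇒highRun φ [] b _ run holds with Do-nil⁻ run
      ... | refl = _ , refl , Equivalence.from (mfF-sound b φ λ _ → refl) holds
      lowRun⇒highRun φ ((A , ts) ∷ αs) b reach run holds =
        let _ , runA , runRest = Do-seqMap-∷⁻ _ (A , ts) αs run
            e , r , runMs      = Equivalence.to (maInst-proper reach A ts) runA
            poss , b′          = back b v A (values ts) e r _ runMs
            sh′ , runAg , holds′ =
              lowRun⇒highRun φ αs b′ (Reachable-step r reach runMs) runRest holds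
        in sh′ , (e , r , poss , runAg) , holds′

      highRun⇒lowRun : ∀ φ αs {sh sl sh′} → B sh sl → Reachable sl →
                       HS.DoAgSeq Mh v αs sh sh′ → HS.Holds Mh v φ sh′ →
                       Σ LS.Sit λ sl′ → LS.Do Ml v (maSeq m αs) sl sl′ × LS.Holds Ml v (mfF m φ) sl′
      highRun⇒lowRun φ [] b _ refl holds = _ , Do-nil , Equivalence.to (mfF-sound b φ λ _ → refl) holds
      highRun⇒lowRun φ ((A , ts) ∷ αs) b reach (e , r , poss , runAg) holds =
        let s₁ , runMs , b′    = forth b v A (values ts) e r poss
            runA               = Equivalence.from (maInst-proper reach A ts) (e , r , runMs)
            sl′ , runRest , holds′ =
              highRun⇒lowRun φ αs b′ (Reachable-step r reach runMs) runAg holds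
        in sl′ , Do-seqMap-∷⁺ _ (A , ts) αs runA runRest , holds′

theorem5 : (R : ℕ → Bool) (Sh Sl : Sig)
           (Dh : Sem.NDBAT R Sh) (Dl : Sem.NDBAT R Sl)
           (m : Abs.RefMap R Sh Sl) →
           Abs.IsRefMap R Sh Sl m Dl →
           Abs.Proper R Sh Sl m Dl →
           (Mh : Sem.Model R Sh) (Ml : Sem.Model R Sl) →
           Sem.IsModel R Sh (Sem.bat Dh) Mh →
           Sem.IsModel R Sl (Sem.bat Dl) Ml →
           Abs.Bisimilar R Sh Sl m Mh Ml →
           (αs : List (Σ (Fin (Sig.nA Sh)) λ A → Vec (Term 0) (Sig.ar Sh A)))
           (φ : Lang.Formula Sh 0) (v : ℕ → ℕ) →
           (Σ (Sem.Sit R Sl) λ s' →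
              Sem.Do R Sl Ml v (Abs.maSeq R Sh Sl m αs) [] s'
              × Sem.Holds R Sl Ml v (Abs.mfF R Sh Sl m φ) s')
           ⇔ (Σ (Sem.Sit R Sh) λ s' →
              Sem.DoAgSeq R Sh Mh v αs [] s' × Sem.Holds R Sh Mh v φ s')
theorem5 R Sh Sl _ Dl m _ proper Mh Ml _ isMl (B , isB , S₀∼S₀) αs φ v =
  mk⇔ (λ (_ , run , holds) → lowRun⇒highRun φ αs S₀∼S₀ S₀-reachable run holds)
      (λ (_ , run , holds) → highRun⇒lowRun φ αs S₀∼S₀ S₀-reachable run holds)
  where
    open Refinement.Bisimulation.Runs R Sh Sl m Mh Ml B isB Dl proper isMl v
    S₀-reachable : Reachable []
    S₀-reachable = [] , Sequencing.Do-nil R Sl Ml v
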